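{- Let $\Delta$ be a finite multiset of formulas of classical linear logic built from the grammar $A,B ::= \mathbf{1} \mid \bot \mid A\otimes B \mid A ⅋ B \mid A\oplus B \mid A \,\&\, B \mid {!A} \mid {?A}$. If the one-sided sequent $\vdash \Delta$ is provable in $\mathrm{CLL}+\mathrm{Mix}_0$, then the sequent $\vdash \Delta^{L\bot}, \mathbf{1}$ is provable in $\mathrm{CLL}+\mathrm{Mix}_0$, where $\Delta^{L\bot}$ is obtained by applying $(-)^{L\bot}$ to every formula of $\Delta$.
   Context: $\mathrm{CLL}+\mathrm{Mix}_0$ is the one-sided sequent calculus of classical (propositional, atom-free) linear logic with the usual rules for identity, cut, $\mathbf{1},\bot,\otimes,⅋,\oplus,\&,!,?$, weakening and contraction for $?$-formulas, together with the rule $\mathrm{Mix}_0$ deriving the empty sequent $\vdash\ \cdot$. Linear negation: $\mathbf{1}^\bot=\bot$, $\bot^\bot=\mathbf{1}$, $(A\otimes B)^\bot=A^\bot ⅋ B^\bot$, $(A⅋B)^\bot=A^\bot\otimes B^\bot$, $(A\oplus B)^\bot=A^\bot\&B^\bot$, $(A\&B)^\bot=A^\bot\oplus B^\bot$, $(!A)^\bot=?A^\bot$, $(?A)^\bot=!A^\bot$. The translation $(-)^{L\bot}$ (composition of Laurent's negative translation into intuitionistic linear logic with residual formula $\mathbf{1}$ and the embedding back into CLL) is defined by: $\bot^{L\bot}=\bot$; $\mathbf{1}^{L\bot}=\mathbf{1}\otimes\bot$; $(A\otimes B)^{L\bot}=((A^{L\bot}⅋\mathbf{1})\otimes(B^{L\bot}⅋\mathbf{1}))\otimes\bot$;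 $(A⅋B)^{L\bot}=A^{L\bot}⅋B^{L\bot}$; $(A\oplus B)^{L\bot}=((A^{L\bot}⅋\mathbf{1})\oplus(B^{L\bot}⅋\mathbf{1}))\otimes\bot$; $(A\&B)^{L\bot}=A^{L\bot}\&B^{L\bot}$; $(!A)^{L\bot}=!(A^{L\bot}⅋\mathbf{1})\otimes\bot$; $(?A)^{L\bot}=?((A^{L\bot}⅋\mathbf{1})\otimes\bot)$. -}

module Defs where

open import Data.List using (List; []; _∷_; _++_; map)
open import Data.List.Relation.Binary.Permutation.Propositional using (_↭_)

infixr 7 _⊗_
infixr 6 _⅋_
infixr 5 _⊕_
infixr 5 _&_
data Fml : Set where
  𝟏 ⊥ : Fml
  _⊗_ _⅋_ _⊕_ _&_ : Fml → Fml → Fml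
  !_ ʔ_ : Fml → Fml

_ᗮ : Fml → Fml
𝟏 ᗮ = ⊥
⊥ ᗮ = 𝟏
(A ⊗ B) ᗮ = (A ᗮ) ⅋ (B ᗮ)
(A ⅋ B) ᗮ = (A ᗮ) ⊗ (B ᗮ)
(A ⊕ B) ᗮ = (A ᗮ) & (B ᗮ)
(A & B) ᗮ = (A ᗮ) ⊕ (B ᗮ)
(! A) ᗮ = ʔ (A ᗮ)
(ʔ A) ᗮ = ! (A ᗮ)

?ctx : List Fml → List Fml
?ctx = map ʔ_

-- One-sided sequent calculus CLL + Mix₀.  Sequents are lists; the
-- exchange rule (arbitrary permutation) makes them multisets.
infix 3 ⊢_
data ⊢_ : List Fml → Set where
  ex    : ∀ {Γ Δ} → Γ ↭ Δ → ⊢ Γ → ⊢ Δ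
  ax    : ∀ {A} → ⊢ A ∷ (A ᗮ) ∷ []
  cut   : ∀ {A Γ Δ} → ⊢ A ∷ Γ → ⊢ (A ᗮ) ∷ Δ → ⊢ Γ ++ Δ
  one   : ⊢ 𝟏 ∷ []
  bot   : ∀ {Γ} → ⊢ Γ → ⊢ ⊥ ∷ Γ
  tens  : ∀ {A B Γ Δ} → ⊢ A ∷ Γ → ⊢ B ∷ Δ → ⊢ (A ⊗ B) ∷ Γ ++ Δ
  par   : ∀ {A B Γ} → ⊢ A ∷ B ∷ Γ → ⊢ (A ⅋ B) ∷ Γ
  plus₁ : ∀ {A B Γ} → ⊢ A ∷ Γ → ⊢ (A ⊕ B) ∷ Γ
  plus₂ : ∀ {A B Γ} → ⊢ B ∷ Γ → ⊢ (A ⊕ B) ∷ Γ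
  with' : ∀ {A B Γ} → ⊢ A ∷ Γ → ⊢ B ∷ Γ → ⊢ (A & B) ∷ Γ
  prom  : ∀ {A Γ} → ⊢ A ∷ ?ctx Γ → ⊢ (! A) ∷ ?ctx Γ
  der   : ∀ {A Γ} → ⊢ A ∷ Γ → ⊢ (ʔ A) ∷ Γ
  weak  : ∀ {A Γ} → ⊢ Γ → ⊢ (ʔ A) ∷ Γ
  contr : ∀ {A Γ} → ⊢ (ʔ A) ∷ (ʔ A) ∷ Γ → ⊢ (ʔ A) ∷ Γ
  mix₀  : ⊢ []

-- Laurent's translation composed with the embedding back into CLL
_ᴸ : Fml → Fml
⊥ ᴸ = ⊥
𝟏 ᴸ = 𝟏 ⊗ ⊥
(A ⊗ B) ᴸ = ((A ᴸ ⅋ 𝟏) ⊗ (B ᴸ ⅋ 𝟏)) ⊗ ⊥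
(A ⅋ B) ᴸ = (A ᴸ) ⅋ (B ᴸ)
(A ⊕ B) ᴸ = ((A ᴸ ⅋ 𝟏) ⊕ (B ᴸ ⅋ 𝟏)) ⊗ ⊥
(A & B) ᴸ = (A ᴸ) & (B ᴸ)
(! A) ᴸ = (! (A ᴸ ⅋ 𝟏)) ⊗ ⊥
(ʔ A) ᴸ = ʔ ((A ᴸ ⅋ 𝟏) ⊗ ⊥)

-- Induction on the derivation, with the residual 𝟏 kept at the end of every
-- translated sequent.  The translation of a positive connective has the shape
-- X ⊗ ⊥: it is built by spending the residual to turn a premise ⊢ A, Γ, 𝟏 into
-- ⊢ A ⅋ 𝟏, Γ, and tensoring with ⊢ ⊥, 𝟏 gives the residual back.  The axiom
-- case is an induction on the formula (ᴸ-axiom); so is the cut case, which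
-- needs the shifted translations Aᴸ ⅋ 𝟏 and (Aᗮ)ᴸ ⅋ 𝟏 to be cuttable against
-- each other at the price of one 𝟏 (ᴸ-coaxiom).
{-# OPTIONS --safe #-}
module Submission where

open import Defs
open import Data.List using (List; []; _∷_; _++_; [_]; map)
open import Data.List.Properties using (map-++; ++-assoc)
open import Data.List.Relation.Binary.Permutation.Propositional using (swap; prep; ↭-refl; ↭-sym)
open import Data.List.Relation.Binary.Permutation.Propositional.Properties
  using (map⁺; ++⁺ʳ; shift; ∷↭∷ʳ)
open import Relation.Binary.PropositionalEquality using (_≡_; refl; sym; cong; subst)

⊢-swap : ∀ {A B Γ} → ⊢ A ∷ B ∷ Γ → ⊢ B ∷ A ∷ Γ
⊢-swap = ex (swap _ _ ↭-refl)

⊢-shift : ∀ {A} Γ {Δ} → ⊢ Γ ++ A ∷ Δ → ⊢ A ∷ Γ ++ Δ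
⊢-shift Γ = ex (shift _ Γ _)

⊢-unshift : ∀ {A} Γ {Δ} → ⊢ A ∷ Γ ++ Δ → ⊢ Γ ++ A ∷ Δ
⊢-unshift Γ = ex (↭-sym (shift _ Γ _))

par-𝟏 : ∀ {A} Γ → ⊢ A ∷ Γ ++ [ 𝟏 ] → ⊢ A ⅋ 𝟏 ∷ Γ
par-𝟏 {A} Γ π = par (ex (prep A (↭-sym (∷↭∷ʳ 𝟏 Γ))) π)

tens-⊥ : ∀ {A Γ} → ⊢ A ∷ Γ → ⊢ A ⊗ ⊥ ∷ Γ ++ [ 𝟏 ]
tens-⊥ π = tens π (bot one)

⊗⊥-⅋𝟏 : ∀ {A B Γ} → ⊢ A ∷ B ∷ Γ → ⊢ B ⅋ 𝟏 ∷ A ⊗ ⊥ ∷ Γ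
⊗⊥-⅋𝟏 π = par-𝟏 _ (⊢-swap (tens-⊥ π))

cut-𝟏 : ∀ {A} Γ {Δ} → ⊢ A ∷ Γ ++ [ 𝟏 ] → ⊢ (A ⅋ 𝟏) ᗮ ∷ Δ → ⊢ Γ ++ Δ
cut-𝟏 Γ π ρ = cut (par-𝟏 Γ π) ρ

prom-der : ∀ {A B} → ⊢ A ∷ [ B ] → ⊢ ! A ∷ [ ʔ B ]
prom-der {B = B} π = prom {Γ = [ B ]} (⊢-swap (der (⊢-swap π)))

⊗⅋-axiom : ∀ {P P' R R'} → ⊢ P ∷ P' ∷ [ 𝟏 ] → ⊢ R ∷ R' ∷ [ 𝟏 ] →
           ⊢ ((P ⅋ 𝟏) ⊗ (R ⅋ 𝟏)) ⊗ ⊥ ∷ P' ⅋ R' ∷ [ 𝟏 ]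
⊗⅋-axiom π ρ =
  ⊢-swap (par (⊢-unshift (_ ∷ _ ∷ []) (tens-⊥ (tens (par-𝟏 [ _ ] π) (par-𝟏 [ _ ] ρ)))))

⊕&-axiom : ∀ {P P' R R'} → ⊢ P ∷ P' ∷ [ 𝟏 ] → ⊢ R ∷ R' ∷ [ 𝟏 ] →
           ⊢ ((P ⅋ 𝟏) ⊕ (R ⅋ 𝟏)) ⊗ ⊥ ∷ (P' & R') ∷ [ 𝟏 ]
⊕&-axiom π ρ = ⊢-swap (with' (⊢-swap (tens-⊥ (plus₁ (par-𝟏 [ _ ] π))))
                             (⊢-swap (tens-⊥ (plus₂ (par-𝟏 [ _ ] ρ)))))

!ʔ-axiom : ∀ {P P'} → ⊢ P ∷ P' ∷ [ 𝟏 ] → ⊢ ! (P ⅋ 𝟏) ⊗ ⊥ ∷ ʔ ((P' ⅋ 𝟏) ⊗ ⊥) ∷ [ 𝟏 ]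
!ʔ-axiom π = tens-⊥ (prom-der (⊗⊥-⅋𝟏 (par-𝟏 [ _ ] (⊢-swap π))))

ᴸ-axiom : ∀ A → ⊢ A ᴸ ∷ (A ᗮ) ᴸ ∷ [ 𝟏 ]
ᴸ-axiom 𝟏       = tens one (bot (bot one))
ᴸ-axiom ⊥       = bot (tens-⊥ one)
ᴸ-axiom (A ⊗ B) = ⊗⅋-axiom (ᴸ-axiom A) (ᴸ-axiom B)
ᴸ-axiom (A ⅋ B) = ⊢-swap (⊗⅋-axiom (⊢-swap (ᴸ-axiom A)) (⊢-swap (ᴸ-axiom B)))
ᴸ-axiom (A ⊕ B) = ⊕&-axiom (ᴸ-axiom A) (ᴸ-axiom B)
ᴸ-axiom (A & B) = ⊢-swap (⊕&-axiom (⊢-swap (ᴸ-axiom A)) (⊢-swap (ᴸ-axiom B)))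
ᴸ-axiom (! A)   = !ʔ-axiom (ᴸ-axiom A)
ᴸ-axiom (ʔ A)   = ⊢-swap (!ʔ-axiom (⊢-swap (ᴸ-axiom A)))

⊗⊥-monoidal : ∀ P R → ⊢ ((P ⊗ ⊥) ⅋ 𝟏) ᗮ ∷ ((R ⊗ ⊥) ⅋ 𝟏) ᗮ ∷ (P ⊗ R) ⊗ ⊥ ∷ [ 𝟏 ]
⊗⊥-monoidal P R = ⊢-swap (tens-⊥ (par-𝟏 (_ ∷ _ ∷ [])
  (⊢-shift (_ ∷ _ ∷ []) (tens-⊥ (⊗⊥-⅋𝟏 (tens (ax {P}) (ax {R})))))))

⊗⅋-coaxiom : ∀ {U U' V V'} → ⊢ U ⊗ ⊥ ∷ U' ⊗ ⊥ ∷ [ 𝟏 ] → ⊢ V ⊗ ⊥ ∷ V' ⊗ ⊥ ∷ [ 𝟏 ] →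
             ⊢ (((U ⊗ ⊥) ⅋ (V ⊗ ⊥)) ⅋ 𝟏) ⊗ ⊥ ∷ (U' ⊗ V') ⊗ ⊥ ∷ [ 𝟏 ]
⊗⅋-coaxiom {U' = U'} {V' = V'} π ρ = tens-⊥ (par-𝟏 [ _ ] (par (⊢-swap
  (cut-𝟏 [ _ ] (⊢-swap ρ) (⊢-swap (cut-𝟏 [ _ ] (⊢-swap π) (⊗⊥-monoidal U' V')))))))

⊕&-coaxiom : ∀ {U U' V V'} → ⊢ U ⊗ ⊥ ∷ U' ⊗ ⊥ ∷ [ 𝟏 ] → ⊢ V ⊗ ⊥ ∷ V' ⊗ ⊥ ∷ [ 𝟏 ] →
             ⊢ (((U ⊗ ⊥) & (V ⊗ ⊥)) ⅋ 𝟏) ⊗ ⊥ ∷ (U' ⊕ V') ⊗ ⊥ ∷ [ 𝟏 ]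
⊕&-coaxiom π ρ = tens-⊥ (par-𝟏 [ _ ] (with'
  (cut-𝟏 [ _ ] (⊢-swap π) (tens-⊥ (⊗⊥-⅋𝟏 (plus₁ ax))))
  (cut-𝟏 [ _ ] (⊢-swap ρ) (tens-⊥ (⊗⊥-⅋𝟏 (plus₂ ax))))))

!ʔ-coaxiom : ∀ {U U'} → ⊢ U ⊗ ⊥ ∷ U' ⊗ ⊥ ∷ [ 𝟏 ] →
             ⊢ (ʔ (U ⊗ ⊥) ⅋ 𝟏) ⊗ ⊥ ∷ ! ((U' ⊗ ⊥) ⅋ 𝟏) ⊗ ⊥ ∷ [ 𝟏 ]
!ʔ-coaxiom π = tens-⊥ (⊗⊥-⅋𝟏 (prom-der (par-𝟏 [ _ ] (⊢-swap π))))

ᴸ-coaxiom : ∀ A → ⊢ (A ᴸ ⅋ 𝟏) ᗮ ∷ ((A ᗮ) ᴸ ⅋ 𝟏) ᗮ ∷ [ 𝟏 ]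
ᴸ-coaxiom 𝟏       = tens (par (bot one)) (bot (tens-⊥ one))
ᴸ-coaxiom ⊥       = tens one (bot (tens-⊥ (par (bot one))))
ᴸ-coaxiom (A ⊗ B) = ⊗⅋-coaxiom (ᴸ-coaxiom A) (ᴸ-coaxiom B)
ᴸ-coaxiom (A ⅋ B) = ⊢-swap (⊗⅋-coaxiom (⊢-swap (ᴸ-coaxiom A)) (⊢-swap (ᴸ-coaxiom B)))
ᴸ-coaxiom (A ⊕ B) = ⊕&-coaxiom (ᴸ-coaxiom A) (ᴸ-coaxiom B)
ᴸ-coaxiom (A & B) = ⊢-swap (⊕&-coaxiom (⊢-swap (ᴸ-coaxiom A)) (⊢-swap (ᴸ-coaxiom B)))
ᴸ-coaxiom (! A)   = !ʔ-coaxiom (ᴸ-coaxiom A)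
ᴸ-coaxiom (ʔ A)   = ⊢-swap (!ʔ-coaxiom (⊢-swap (ᴸ-coaxiom A)))

ᴸ-cut : ∀ {A Γ Δ} → ⊢ A ᴸ ∷ Γ ++ [ 𝟏 ] → ⊢ (A ᗮ) ᴸ ∷ Δ ++ [ 𝟏 ] → ⊢ (Γ ++ Δ) ++ [ 𝟏 ]
ᴸ-cut {A} {Γ} {Δ} π ρ = subst ⊢_ (sym (++-assoc Γ Δ [ 𝟏 ]))
  (cut-𝟏 Γ π (⊢-shift Δ (cut-𝟏 Δ ρ (⊢-swap (ᴸ-coaxiom A)))))

ᴸ-?ctx : ∀ Γ → map _ᴸ (?ctx Γ) ≡ ?ctx (map (λ B → (B ᴸ ⅋ 𝟏) ⊗ ⊥) Γ)
ᴸ-?ctx []      = refl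
ᴸ-?ctx (_ ∷ Γ) = cong (_ ∷_) (ᴸ-?ctx Γ)

ᴸ-prom : ∀ {A} Γ → ⊢ A ⅋ 𝟏 ∷ map _ᴸ (?ctx Γ) → ⊢ ! (A ⅋ 𝟏) ∷ map _ᴸ (?ctx Γ)
ᴸ-prom Γ π rewrite ᴸ-?ctx Γ = prom π

theorem7 : (Δ : List Fml) → ⊢ Δ → ⊢ map _ᴸ Δ ++ 𝟏 ∷ []
theorem7 _ (ex p π)          = ex (++⁺ʳ [ 𝟏 ] (map⁺ _ᴸ p)) (theorem7 _ π)
theorem7 _ (ax {A})          = ᴸ-axiom A
theorem7 _ (cut {Γ = Γ} {Δ} π ρ) =
  subst (λ Θ → ⊢ Θ ++ [ 𝟏 ]) (sym (map-++ _ᴸ Γ Δ)) (ᴸ-cut (theorem7 _ π) (theorem7 _ ρ))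
theorem7 _ one               = tens-⊥ one
theorem7 _ (bot π)           = bot (theorem7 _ π)
theorem7 _ (tens {Γ = Γ} {Δ} π ρ) = subst (λ Θ → ⊢ _ ∷ Θ ++ [ 𝟏 ]) (sym (map-++ _ᴸ Γ Δ))
  (tens-⊥ (tens (par-𝟏 _ (theorem7 _ π)) (par-𝟏 _ (theorem7 _ ρ))))
theorem7 _ (par π)           = par (theorem7 _ π)
theorem7 _ (plus₁ π)         = tens-⊥ (plus₁ (par-𝟏 _ (theorem7 _ π)))
theorem7 _ (plus₂ π)         = tens-⊥ (plus₂ (par-𝟏 _ (theorem7 _ π)))
theorem7 _ (with' π ρ)       = with' (theorem7 _ π) (theorem7 _ ρ)
theorem7 _ (prom {Γ = Γ} π)  = tens-⊥ (ᴸ-prom Γ (par-𝟏 _ (theorem7 _ π)))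
theorem7 _ (der π)           = der (tens-⊥ (par-𝟏 _ (theorem7 _ π)))
theorem7 _ (weak π)          = weak (theorem7 _ π)
theorem7 _ (contr π)         = contr (theorem7 _ π)
theorem7 _ mix₀              = one
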